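{- For every positive integer $n$, $\mathrm{mp}(P_n \Box P_2) = \left\lceil \frac{2n}{5} \right\rceil$.
   Context: $P_n \Box P_2$ denotes the Cartesian product of the path on $n$ vertices with the path on $2$ vertices. For a graph $G$ with shortest-path distance $d$, let $N_r(v) = \{u : d(u,v) \leq r\}$. A multipacking of $G$ is a set $M \subseteq V(G)$ such that for every vertex $v$ and every positive integer $r$, $|N_r(v) \cap M| \leq r$; $\mathrm{mp}(G)$ is the maximum size of a multipacking of $G$. -}

module Defs where

open import Data.Nat using (ℕ; zero; suc; _+_; _*_; _≤_)
open import Data.Nat.DivMod using (_/_)
open import Data.Fin using (Fin; toℕ)
open import Data.Product using (_×_; _,_; Σ; ∃)
open import Data.Sum using (_⊎_)
open import Data.List using (List; length)
open import Data.List.Membership.Propositional using (_∈_)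
open import Data.List.Relation.Unary.Unique.Propositional using (Unique)
open import Relation.Binary.PropositionalEquality using (_≡_)

PathAdj : (n : ℕ) → Fin n → Fin n → Set
PathAdj n i j = (suc (toℕ i) ≡ toℕ j) ⊎ (suc (toℕ j) ≡ toℕ i)

V : ℕ → Set
V n = Fin n × Fin 2

Adj : (n : ℕ) → V n → V n → Set
Adj n (i , a) (j , b) = ((i ≡ j) × PathAdj 2 a b) ⊎ ((a ≡ b) × PathAdj n i j)

data Walk (n : ℕ) : V n → V n → ℕ → Set where
  here : ∀ {u} → Walk n u u zero
  step : ∀ {u w v k} → Adj n u w → Walk n w v k → Walk n u v (suc k)

-- Shortest-path distance d(v,u) ≤ r  iff  some walk from v to u has length ≤ r.
-- So u ∈ N_r(v) is:
InBall : (n : ℕ) → ℕ → V n → V n → Set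
InBall n r v u = Σ ℕ λ k → (k ≤ r) × Walk n v u k

-- M ⊆ V, given as a duplicate-free list. |N_r(v) ∩ M| ≤ r is expressed as:
-- every duplicate-free list of vertices lying in N_r(v) ∩ M has length ≤ r.
IsMultipacking : (n : ℕ) → List (V n) → Set
IsMultipacking n M =
  Unique M ×
  (∀ (v : V n) (r : ℕ) → 1 ≤ r →
     ∀ (L : List (V n)) → Unique L →
       (∀ {u} → u ∈ L → (u ∈ M) × InBall n r v u) →
       length L ≤ r)

MpEquals : (n : ℕ) → ℕ → Set
MpEquals n m =
  (Σ (List (V n)) λ M → IsMultipacking n M × (length M ≡ m)) ×
  (∀ (M : List (V n)) → IsMultipacking n M → length M ≤ m)

-- ⌈ a / 5 ⌉ = ⌊ (a + 4) / 5 ⌋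
ceil5 : ℕ → ℕ
ceil5 a = (a + 4) / 5

-- Number the vertices along the ladder by  rank (i , a) = 2i + a.
-- An edge changes the rank by at most 2, so a ball of radius r around v only
-- contains vertices whose rank lies within 2r of rank v.  Hence if every vertex
-- of M has rank divisible by 5, the points of M in such a ball have ranks among
-- at most r multiples of 5 (a window of width 4r < 5r), and M is a multipacking.
-- The vertices of rank 0, 5, 10, ..., below 2n give ⌈2n/5⌉ such points.
--
-- A multipacking has at most one point per column (two points of a
-- column share a ball of radius 1), so it is no larger than its set S of occupied
-- columns.  S contains no two consecutive columns (radius 1) and no columns
-- i, i+2, i+4 (radius 2); any such "sparse" set of columns below m has at most
-- two elements in every five consecutive columns, whence |S| ≤ ⌈2m/5⌉.
module Submission where

open import Defs
open import Data.Nat using (ℕ; zero; suc; _+_; _*_; _∸_; _≤_; _<_; z≤n; s≤s; ∣_-_∣; _≟_)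
open import Data.Nat.Properties
open import Data.Nat.DivMod
open import Data.Nat.Divisibility using (_∣_; divides; divides-refl)
open import Data.Nat.Tactic.RingSolver using (solve-∀)
open import Data.Fin using (Fin; toℕ; fromℕ<) renaming (zero to fzero; suc to fsuc)
open import Data.Fin.Properties using (toℕ-injective; toℕ-fromℕ<; toℕ<n; injective⇒≤) renaming (_≟_ to _≟ᶠ_)
open import Data.Product using (Σ; _×_; _,_; proj₁; proj₂)
open import Data.Sum using (inj₁; inj₂)
open import Data.List using (List; []; _∷_; _++_; length; lookup; map; filter; upTo; tabulate)
open import Data.List.Properties using (length-++; filter-++; upTo-∷ʳ; length-upTo; length-tabulate)
open import Data.List.Relation.Unary.Any as Any using (here; there)
open import Data.List.Relation.Unary.Any.Properties using (lookup-index)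
open import Data.List.Relation.Unary.All as All using ([]; _∷_)
open import Data.List.Relation.Unary.AllPairs using ([]; _∷_)
open import Data.List.Membership.Propositional using (_∈_)
open import Data.List.Membership.Propositional.Properties using (∈-map⁺; ∈-map⁻; ∈-filter⁺; ∈-upTo⁺; ∈-tabulate⁻)
open import Data.List.Membership.Setoid.Properties using (∈-lookup)
open import Data.List.Membership.DecPropositional _≟_ using (_∈?_)
open import Data.List.Relation.Unary.Unique.Propositional using (Unique)
open import Data.List.Relation.Unary.Unique.Propositional.Properties using (tabulate⁺)
open import Data.Empty using (⊥; ⊥-elim)
open import Function.Base using (_∘′_)
open import Function.Definitions using (Injective)
open import Relation.Nullary using (Dec; yes; no; contradiction)
open import Relation.Unary using (Decidable)
open import Relation.Binary.PropositionalEquality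

lookup-injective : ∀ {A : Set} {xs : List A} → Unique xs →
                   ∀ i j → lookup xs i ≡ lookup xs j → i ≡ j
lookup-injective {xs = _ ∷ _}  (_ ∷ _)      fzero    fzero    _  = refl
lookup-injective {xs = _ ∷ xs} (x∉xs ∷ _)   fzero    (fsuc j) eq =
  contradiction eq (All.lookup x∉xs (∈-lookup (setoid _) xs j))
lookup-injective {xs = _ ∷ xs} (x∉xs ∷ _)   (fsuc i) fzero    eq =
  contradiction (sym eq) (All.lookup x∉xs (∈-lookup (setoid _) xs i))
lookup-injective {xs = _ ∷ _}  (_ ∷ unique) (fsuc i) (fsuc j) eq =
  cong fsuc (lookup-injective unique i j eq)

-- Sending each position of L to the
-- position in K of the image of its entry is an injection Fin |L| → Fin |K|.
pigeonhole : ∀ {A B : Set} {L : List A} {K : List B} (f : A → B) → Unique L →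
             (∀ {x y} → x ∈ L → y ∈ L → f x ≡ f y → x ≡ y) →
             (∀ {x} → x ∈ L → f x ∈ K) → length L ≤ length K
pigeonhole {L = L} {K} f unique f-injective f-into = injective⇒≤ target-injective
  where
    entry : ∀ i → lookup L i ∈ L
    entry = ∈-lookup (setoid _) L

    target : Fin (length L) → Fin (length K)
    target i = Any.index (f-into (entry i))

    lookup-target : ∀ i → f (lookup L i) ≡ lookup K (target i)
    lookup-target i = lookup-index (f-into (entry i))

    target-injective : Injective _≡_ _≡_ target
    target-injective {i} {j} eq = lookup-injective unique i j
      (f-injective (entry i) (entry j)
        (trans (lookup-target i) (trans (cong (lookup K) eq) (sym (lookup-target j)))))

indicator : ∀ {Q : Set} → Dec Q → ℕ
indicator (yes _) = 1
indicator (no _)  = 0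

count : ∀ {P : ℕ → Set} → Decidable P → ℕ → ℕ
count P? zero    = 0
count P? (suc m) = indicator (P? m) + count P? m

length-filter-upTo : ∀ {P : ℕ → Set} (P? : Decidable P) m →
                     length (filter P? (upTo m)) ≡ count P? m
length-filter-upTo P? zero    = refl
length-filter-upTo P? (suc m) = begin
  length (filter P? (upTo (suc m)))                   ≡⟨ cong (length ∘′ filter P?) (sym (upTo-∷ʳ m)) ⟩
  length (filter P? (upTo m ++ m ∷ []))                ≡⟨ cong length (filter-++ P? (upTo m) (m ∷ [])) ⟩
  length (filter P? (upTo m) ++ filter P? (m ∷ []))    ≡⟨ length-++ (filter P? (upTo m)) ⟩
  length (filter P? (upTo m)) + length (filter P? (m ∷ []))
                                                      ≡⟨ cong₂ _+_ (length-filter-upTo P? m) singleton ⟩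
  count P? m + indicator (P? m)                        ≡⟨ +-comm (count P? m) _ ⟩
  count P? (suc m)                                     ∎
  where
    open ≡-Reasoning
    singleton : length (filter P? (m ∷ [])) ≡ indicator (P? m)
    singleton with P? m
    ... | yes _ = refl
    ... | no _  = refl

count-mono : ∀ {P : ℕ → Set} (P? : Decidable P) k m → count P? m ≤ count P? (k + m)
count-mono P? zero    m = ≤-refl
count-mono P? (suc k) m = ≤-trans (count-mono P? k m) (m≤n+m _ (indicator (P? (k + m))))

ceil5-step : ∀ m → ceil5 (2 * (5 + m)) ≡ 2 + ceil5 (2 * m)
ceil5-step m = begin
  (2 * (5 + m) + 4) / 5       ≡⟨ cong (_/ 5) (rearrange m) ⟩
  (2 * 5 + (2 * m + 4)) / 5   ≡⟨ +-distrib-/-∣ˡ {2 * 5} (2 * m + 4) {5} (divides-refl 2) ⟩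
  2 + (2 * m + 4) / 5         ∎
  where
    open ≡-Reasoning
    rearrange : ∀ m → 2 * (5 + m) + 4 ≡ 2 * 5 + (2 * m + 4)
    rearrange = solve-∀

record Sparse (P : ℕ → Set) : Set where
  field
    no-pair   : ∀ i → P i → P (1 + i) → ⊥
    no-triple : ∀ i → P i → P (2 + i) → P (4 + i) → ⊥

module _ {P : ℕ → Set} (sparse : Sparse P) (P? : Decidable P) where
  open Sparse sparse

  -- Two consecutive positions hold at most one point of a sparse set
  -- (stated with an accumulator X so that it matches the unfolding of count).
  pair-window : ∀ m X → indicator (P? (1 + m)) + (indicator (P? m) + X) ≤ 1 + X
  pair-window m X with P? m | P? (1 + m)
  ... | yes p | yes q = ⊥-elim (no-pair m p q)
  ... | yes _ | no _  = ≤-refl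
  ... | no _  | yes _ = ≤-refl
  ... | no _  | no _  = n≤1+n X

  five-window : ∀ m X → indicator (P? (4 + m)) + (indicator (P? (3 + m)) + (indicator (P? (2 + m)) +
                          (indicator (P? (1 + m)) + (indicator (P? m) + X)))) ≤ 2 + X
  five-window m X with P? m | P? (1 + m) | P? (2 + m) | P? (3 + m) | P? (4 + m)
  ... | yes p | yes q | _     | _     | _     = ⊥-elim (no-pair m p q)
  ... | _     | yes p | yes q | _     | _     = ⊥-elim (no-pair (1 + m) p q)
  ... | _     | _     | yes p | yes q | _     = ⊥-elim (no-pair (2 + m) p q)
  ... | _     | _     | _     | yes p | yes q = ⊥-elim (no-pair (3 + m) p q)
  ... | yes p | no _  | yes q | no _  | yes r = ⊥-elim (no-triple m p q r)
  ... | yes _ | no _  | yes _ | no _  | no _  = ≤-refl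
  ... | yes _ | no _  | no _  | yes _ | no _  = ≤-refl
  ... | yes _ | no _  | no _  | no _  | yes _ = ≤-refl
  ... | yes _ | no _  | no _  | no _  | no _  = n≤1+n (1 + X)
  ... | no _  | yes _ | no _  | yes _ | no _  = ≤-refl
  ... | no _  | yes _ | no _  | no _  | yes _ = ≤-refl
  ... | no _  | yes _ | no _  | no _  | no _  = n≤1+n (1 + X)
  ... | no _  | no _  | yes _ | no _  | yes _ = ≤-refl
  ... | no _  | no _  | yes _ | no _  | no _  = n≤1+n (1 + X)
  ... | no _  | no _  | no _  | yes _ | no _  = n≤1+n (1 + X)
  ... | no _  | no _  | no _  | no _  | yes _ = n≤1+n (1 + X)
  ... | no _  | no _  | no _  | no _  | no _  = m≤n+m X 2

  sparse-count : ∀ m → count P? m ≤ ceil5 (2 * m)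
  sparse-count 0 = z≤n
  sparse-count 1 = ≤-trans (count-mono P? 1 1) (pair-window 0 0)
  sparse-count 2 = pair-window 0 0
  sparse-count 3 = ≤-trans (count-mono P? 2 3) (five-window 0 0)
  sparse-count 4 = ≤-trans (count-mono P? 1 4) (five-window 0 0)
  sparse-count (suc (suc (suc (suc (suc m))))) = begin
    count P? (5 + m)           ≤⟨ five-window m (count P? m) ⟩
    2 + count P? m             ≤⟨ +-monoʳ-≤ 2 (sparse-count m) ⟩
    2 + ceil5 (2 * m)          ≡⟨ ceil5-step m ⟨
    ceil5 (2 * (5 + m))        ∎
    where open ≤-Reasoning

adj-sym : ∀ {n} {u w : V n} → Adj n u w → Adj n w u
adj-sym (inj₁ (refl , inj₁ e)) = inj₁ (refl , inj₂ e)
adj-sym (inj₁ (refl , inj₂ e)) = inj₁ (refl , inj₁ e)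
adj-sym (inj₂ (refl , inj₁ e)) = inj₂ (refl , inj₂ e)
adj-sym (inj₂ (refl , inj₂ e)) = inj₂ (refl , inj₁ e)

rail : ∀ {n} {i j : Fin n} (a : Fin 2) → suc (toℕ i) ≡ toℕ j → Adj n (i , a) (j , a)
rail a e = inj₂ (refl , inj₁ e)

rung : ∀ {n} (i : Fin n) {a b : Fin 2} → a ≢ b → Adj n (i , a) (i , b)
rung i {fzero}      {fzero}      a≢b = ⊥-elim (a≢b refl)
rung i {fzero}      {fsuc fzero} _   = inj₁ (refl , inj₁ refl)
rung i {fsuc fzero} {fzero}      _   = inj₁ (refl , inj₂ refl)
rung i {fsuc fzero} {fsuc fzero} a≢b = ⊥-elim (a≢b refl)

common-neighbour : ∀ {n} {i j : Fin n} (a : Fin 2) → toℕ j ≡ 2 + toℕ i →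
                   Σ (V n) λ m → Adj n m (i , a) × Adj n m (j , a)
common-neighbour {n} {i} {j} a j≡2+i =
  (fromℕ< k<n , a) ,
  adj-sym (rail a (sym (toℕ-fromℕ< k<n))) ,
  rail a (trans (cong suc (toℕ-fromℕ< k<n)) (sym j≡2+i))
  where
    k<n : suc (toℕ i) < n
    k<n = ≤-trans (n≤1+n _) (subst (_< n) j≡2+i (toℕ<n j))

other-row : ∀ {a b c : Fin 2} → a ≢ b → b ≢ c → a ≡ c
other-row {fzero}      {fzero}      a≢b _   = ⊥-elim (a≢b refl)
other-row {fsuc fzero} {fsuc fzero} a≢b _   = ⊥-elim (a≢b refl)
other-row {fzero}      {fsuc fzero} {fzero}      _ _   = refl
other-row {fsuc fzero} {fzero}      {fsuc fzero} _ _   = refl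
other-row {fzero}      {fsuc fzero} {fsuc fzero} _ b≢c = ⊥-elim (b≢c refl)
other-row {fsuc fzero} {fzero}      {fzero}      _ b≢c = ⊥-elim (b≢c refl)

ball-centre : ∀ {n r} (v : V n) → InBall n r v v
ball-centre v = 0 , z≤n , here

ball-adj : ∀ {n r} {v u : V n} → 1 ≤ r → Adj n v u → InBall n r v u
ball-adj 1≤r e = 1 , 1≤r , step e here

ball-two : ∀ {n} {v w u : V n} → Adj n v w → Adj n w u → InBall n 2 v u
ball-two e f = 2 , ≤-refl , step e (step f here)

same-column : ∀ {n} (i : Fin n) (a b : Fin 2) → InBall n 1 (i , a) (i , b)
same-column i a b with a ≟ᶠ b
... | yes refl = ball-centre (i , a)
... | no a≢b   = ball-adj ≤-refl (rung i a≢b)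

column : ∀ {n} → V n → ℕ
column (i , _) = toℕ i

columns-apart : ∀ {n} {x y : V n} d → column y ≡ suc d + column x → x ≢ y
columns-apart {x = x} d y-right-of-x x≡y = m≢1+n+m (column x) {d} (trans (cong column x≡y) y-right-of-x)

module Packing {n : ℕ} {M : List (V n)} (packing : IsMultipacking n M) where

  packing-pair : ∀ {x y} → x ∈ M → y ∈ M → x ≢ y → (v : V n) →
                 InBall n 1 v x → InBall n 1 v y → ⊥
  packing-pair {x} {y} x∈M y∈M x≢y v x∈B y∈B =
    1+n≰n (proj₂ packing v 1 ≤-refl (x ∷ y ∷ []) ((x≢y ∷ []) ∷ [] ∷ []) members)
    where
      members : ∀ {u} → u ∈ x ∷ y ∷ [] → (u ∈ M) × InBall n 1 v u
      members (here refl)         = x∈M , x∈B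
      members (there (here refl)) = y∈M , y∈B

  packing-triple : ∀ {x y z} → x ∈ M → y ∈ M → z ∈ M → x ≢ y → x ≢ z → y ≢ z → (v : V n) →
                   InBall n 2 v x → InBall n 2 v y → InBall n 2 v z → ⊥
  packing-triple {x} {y} {z} x∈M y∈M z∈M x≢y x≢z y≢z v x∈B y∈B z∈B =
    1+n≰n (proj₂ packing v 2 (s≤s z≤n) (x ∷ y ∷ z ∷ [])
             ((x≢y ∷ x≢z ∷ []) ∷ (y≢z ∷ []) ∷ [] ∷ []) members)
    where
      members : ∀ {u} → u ∈ x ∷ y ∷ z ∷ [] → (u ∈ M) × InBall n 2 v u
      members (here refl)                 = x∈M , x∈B
      members (there (here refl))         = y∈M , y∈B
      members (there (there (here refl))) = z∈M , z∈B

  column-injective : ∀ {x y} → x ∈ M → y ∈ M → column x ≡ column y → x ≡ y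
  column-injective {i , a} {j , b} x∈M y∈M e with toℕ-injective e | a ≟ᶠ b
  ... | refl | yes refl = refl
  ... | refl | no a≢b   = ⊥-elim (packing-pair x∈M y∈M (λ q → a≢b (cong proj₂ q)) (i , a)
                                    (ball-centre (i , a)) (same-column i a b))

  -- Points in adjacent columns lie in a common unit ball.
  adjacent-columns : ∀ {i j a b} → (i , a) ∈ M → (j , b) ∈ M → suc (toℕ i) ≡ toℕ j → ⊥
  adjacent-columns {i} {j} {a} {b} x∈M y∈M j≡1+i =
    packing-pair x∈M y∈M (λ q → 1+n≢n (trans j≡1+i (sym (cong column q)))) (i , b)
      (same-column i b a) (ball-adj ≤-refl (rail b j≡1+i))

  -- Points in columns i, i+2, i+4: if two consecutive ones share a row they lie
  -- in the unit ball around the vertex between them; otherwise the outer two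
  -- share a row and all three lie in the ball of radius 2 around the middle column.
  spaced-columns : ∀ {i j k a b c} → (i , a) ∈ M → (j , b) ∈ M → (k , c) ∈ M →
                   toℕ j ≡ 2 + toℕ i → toℕ k ≡ 2 + toℕ j → ⊥
  spaced-columns {a = a} {b} {c} x∈M y∈M z∈M j≡2+i k≡2+j
    with common-neighbour a j≡2+i | common-neighbour c k≡2+j | a ≟ᶠ b | b ≟ᶠ c
  ... | m , m~x , m~y | _ | yes refl | _ =
    packing-pair x∈M y∈M (columns-apart 1 j≡2+i) m (ball-adj ≤-refl m~x) (ball-adj ≤-refl m~y)
  ... | _ | m′ , m′~y , m′~z | no _ | yes refl =
    packing-pair y∈M z∈M (columns-apart 1 k≡2+j) m′ (ball-adj ≤-refl m′~y) (ball-adj ≤-refl m′~z)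
  ... | m , m~x , m~y | m′ , m′~y , m′~z | no a≢b | no b≢c with other-row a≢b b≢c
  ...   | refl =
    packing-triple x∈M y∈M z∈M
      (columns-apart 1 j≡2+i) (columns-apart 3 (trans k≡2+j (cong (2 +_) j≡2+i))) (columns-apart 1 k≡2+j)
      (_ , a) (ball-two (adj-sym m~y) m~x) (ball-adj (s≤s z≤n) (rung _ a≢b)) (ball-two (adj-sym m′~y) m′~z)

  Occupied : ℕ → Set
  Occupied t = t ∈ map column M

  occupied? : Decidable Occupied
  occupied? t = t ∈? map column M

  occupied-sparse : Sparse Occupied
  occupied-sparse = record { no-pair = no-pair ; no-triple = no-triple }
    where
      no-pair : ∀ t → Occupied t → Occupied (1 + t) → ⊥
      no-pair t t∈ 1+t∈ with ∈-map⁻ column t∈ | ∈-map⁻ column 1+t∈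
      ... | _ , x∈M , refl | _ , y∈M , e = adjacent-columns x∈M y∈M e
      no-triple : ∀ t → Occupied t → Occupied (2 + t) → Occupied (4 + t) → ⊥
      no-triple t t∈ 2+t∈ 4+t∈ with ∈-map⁻ column t∈ | ∈-map⁻ column 2+t∈ | ∈-map⁻ column 4+t∈
      ... | _ , x∈M , refl | _ , y∈M , e | _ , z∈M , e′ =
        spaced-columns x∈M y∈M z∈M (sym e) (trans (sym e′) (cong (2 +_) e))

  size-bound : length M ≤ ceil5 (2 * n)
  size-bound = begin
    length M                                 ≤⟨ pigeonhole column (proj₁ packing) column-injective column-occupied ⟩
    length (filter occupied? (upTo n))       ≡⟨ length-filter-upTo occupied? n ⟩
    count occupied? n                        ≤⟨ sparse-count occupied-sparse occupied? n ⟩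
    ceil5 (2 * n)                            ∎
    where
      open ≤-Reasoning
      column-occupied : ∀ {x} → x ∈ M → column x ∈ filter occupied? (upTo n)
      column-occupied {i , _} x∈M = ∈-filter⁺ occupied? (∈-upTo⁺ (toℕ<n i)) (∈-map⁺ column x∈M)

rank : ∀ {n} → V n → ℕ
rank (i , a) = toℕ i * 2 + toℕ a

row-distance : ∀ (a b : Fin 2) → ∣ toℕ a - toℕ b ∣ ≤ 2
row-distance fzero        fzero        = z≤n
row-distance fzero        (fsuc fzero) = s≤s z≤n
row-distance (fsuc fzero) fzero        = s≤s z≤n
row-distance (fsuc fzero) (fsuc fzero) = z≤n

∣m-2+m∣≡2 : ∀ m → ∣ m - 2 + m ∣ ≡ 2
∣m-2+m∣≡2 m = trans (cong (λ k → ∣ m - k ∣) (+-comm 2 m)) (∣m-m+n∣≡n m 2)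

rank-adj : ∀ {n} {u w : V n} → Adj n u w → ∣ rank u - rank w ∣ ≤ 2
rank-adj {u = i , a} {w = .i , b} (inj₁ (refl , _)) =
  ≤-trans (≤-reflexive (∣m+n-m+o∣≡∣n-o∣ (toℕ i * 2) (toℕ a) (toℕ b))) (row-distance a b)
rank-adj {u = i , a} (inj₂ (refl , inj₁ j≡1+i)) =
  subst (λ c → ∣ rank (i , a) - c * 2 + toℕ a ∣ ≤ 2) j≡1+i (≤-reflexive (∣m-2+m∣≡2 (rank (i , a))))
rank-adj {w = j , b} (inj₂ (refl , inj₂ i≡1+j)) =
  subst (λ c → ∣ c * 2 + toℕ b - rank (j , b) ∣ ≤ 2) i≡1+j
    (≤-reflexive (trans (∣-∣-comm _ (rank (j , b))) (∣m-2+m∣≡2 (rank (j , b)))))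

rank-walk : ∀ {n} {v u : V n} {k} → Walk n v u k → ∣ rank v - rank u ∣ ≤ k * 2
rank-walk {v = v} here = ≤-reflexive (∣n-n∣≡0 (rank v))
rank-walk {v = v} {u} (step {w = w} e walk) = begin
  ∣ rank v - rank u ∣                        ≤⟨ ∣-∣-triangle (rank v) (rank w) (rank u) ⟩
  ∣ rank v - rank w ∣ + ∣ rank w - rank u ∣  ≤⟨ +-mono-≤ (rank-adj e) (rank-walk walk) ⟩
  2 + _                                      ∎
  where open ≤-Reasoning

rank-ball : ∀ {n r} {v u : V n} → InBall n r v u → ∣ rank v - rank u ∣ ≤ r * 2
rank-ball (k , k≤r , walk) = ≤-trans (rank-walk walk) (*-monoˡ-≤ 2 k≤r)

-- The rank determines the vertex: its quotient and remainder by 2 are the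
-- column and the row.
rank-injective : ∀ {n} (u w : V n) → rank u ≡ rank w → u ≡ w
rank-injective {n} u w e = cong₂ _,_ (toℕ-injective (decode (_/ 2) rank-column))
                                     (toℕ-injective (decode (_% 2) rank-row))
  where
    decode : ∀ {g : V n → ℕ} (h : ℕ → ℕ) → (∀ x → h (rank x) ≡ g x) → g u ≡ g w
    decode h h∘rank≡g = trans (sym (h∘rank≡g u)) (trans (cong h e) (h∘rank≡g w))
    rank-column : ∀ (x : V _) → rank x / 2 ≡ toℕ (proj₁ x)
    rank-column (i , a) = begin
      (toℕ i * 2 + toℕ a) / 2      ≡⟨ +-distrib-/-∣ˡ (toℕ a) (divides-refl (toℕ i)) ⟩
      toℕ i * 2 / 2 + toℕ a / 2    ≡⟨ cong₂ _+_ (m*n/n≡m (toℕ i) 2) (m<n⇒m/n≡0 (toℕ<n a)) ⟩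
      toℕ i + 0                    ≡⟨ +-identityʳ (toℕ i) ⟩
      toℕ i                        ∎
      where open ≡-Reasoning
    rank-row : ∀ (x : V _) → rank x % 2 ≡ toℕ (proj₂ x)
    rank-row (i , a) = trans (%-remove-+ˡ (toℕ a) (divides-refl (toℕ i))) (m<n⇒m%n≡m (toℕ<n a))

-- Slots.  Relative to a window centre K and half-width c, a number x is put in
-- slot (x + c ∸ K) / 5.  Moving x by 5d moves its slot by d.
slot-shift : ∀ {K c} s d → K ≤ s * 5 + c → ((s + d) * 5 + c ∸ K) / 5 ≡ d + (s * 5 + c ∸ K) / 5
slot-shift {K} {c} s d K≤s*5+c = begin
  ((s + d) * 5 + c ∸ K) / 5          ≡⟨ cong (λ x → (x ∸ K) / 5) (rearrange s d c) ⟩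
  (d * 5 + (s * 5 + c) ∸ K) / 5      ≡⟨ cong (_/ 5) (+-∸-assoc (d * 5) K≤s*5+c) ⟩
  (d * 5 + (s * 5 + c ∸ K)) / 5      ≡⟨ +-distrib-/-∣ˡ (s * 5 + c ∸ K) (divides-refl d) ⟩
  d * 5 / 5 + (s * 5 + c ∸ K) / 5    ≡⟨ cong (_+ (s * 5 + c ∸ K) / 5) (m*n/n≡m d 5) ⟩
  d + (s * 5 + c ∸ K) / 5            ∎
  where
    open ≡-Reasoning
    rearrange : ∀ s d c → (s + d) * 5 + c ≡ d * 5 + (s * 5 + c)
    rearrange = solve-∀

slot-injective-≤ : ∀ {K c s t} → s ≤ t → K ≤ s * 5 + c →
                   (s * 5 + c ∸ K) / 5 ≡ (t * 5 + c ∸ K) / 5 → s ≡ t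
slot-injective-≤ {s = s} s≤t K≤s*5+c same-slot with m≤n⇒∃[o]m+o≡n s≤t
... | d , refl = sym (trans (cong (s +_) d≡0) (+-identityʳ s))
  where
    d≡0 : d ≡ 0
    d≡0 = +-cancelʳ-≡ _ d 0 (sym (trans same-slot (slot-shift s d K≤s*5+c)))

slot-injective : ∀ {K c x y} → K ≤ x + c → K ≤ y + c → 5 ∣ x → 5 ∣ y →
                 (x + c ∸ K) / 5 ≡ (y + c ∸ K) / 5 → x ≡ y
slot-injective K≤x+c K≤y+c (divides s refl) (divides t refl) same-slot with ≤-total s t
... | inj₁ s≤t = cong (_* 5) (slot-injective-≤ s≤t K≤x+c same-slot)
... | inj₂ t≤s = cong (_* 5) (sym (slot-injective-≤ t≤s K≤y+c (sym same-slot)))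

slot-bound : ∀ {K c r x} → x ≤ K + c → c + c < r * 5 → (x + c ∸ K) / 5 < r
slot-bound {K} {c} {r} {x} x≤K+c 2c<5r = m<n*o⇒m/o<n (begin-strict
  x + c ∸ K          ≤⟨ ∸-monoˡ-≤ K (+-monoˡ-≤ c x≤K+c) ⟩
  K + c + c ∸ K      ≡⟨ cong (_∸ K) (+-assoc K c c) ⟩
  K + (c + c) ∸ K    ≡⟨ m+n∸m≡n K (c + c) ⟩
  c + c              <⟨ 2c<5r ⟩
  r * 5              ∎)
  where open ≤-Reasoning

four-lt-five : ∀ {r} → 1 ≤ r → r * 2 + r * 2 < r * 5
four-lt-five {r} 1≤r = subst (r * 2 + r * 2 <_) (sym (split r)) (m<m+n (r * 2 + r * 2) 1≤r)
  where
    split : ∀ r → r * 5 ≡ r * 2 + r * 2 + r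
    split = solve-∀

-- The points in a ball of radius r around v
-- have ranks within 2r of rank v, so they fall into distinct slots below r.
rank-multiple-of-5-packing : ∀ {n} (M : List (V n)) → Unique M →
                             (∀ {u} → u ∈ M → 5 ∣ rank u) → IsMultipacking n M
rank-multiple-of-5-packing {n} M unique five∣rank = unique , ball-bound
  where
    ball-bound : ∀ v r → 1 ≤ r → ∀ L → Unique L →
                 (∀ {u} → u ∈ L → (u ∈ M) × InBall n r v u) → length L ≤ r
    ball-bound v r 1≤r L uniqueL inside = begin
      length L          ≤⟨ pigeonhole slot uniqueL slot-injective-on-L slot-below-r ⟩
      length (upTo r)   ≡⟨ length-upTo r ⟩
      r                 ∎
      where
        open ≤-Reasoning
        slot : V n → ℕ
        slot u = (rank u + r * 2 ∸ rank v) / 5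

        near : ∀ {u} → u ∈ L → ∣ rank v - rank u ∣ ≤ r * 2
        near u∈L = rank-ball (proj₂ (inside u∈L))

        above : ∀ {u} → u ∈ L → rank v ≤ rank u + r * 2
        above {u} u∈L = ≤-trans (m≤n+∣m-n∣ (rank v) (rank u)) (+-monoʳ-≤ (rank u) (near u∈L))

        below : ∀ {u} → u ∈ L → rank u ≤ rank v + r * 2
        below {u} u∈L = ≤-trans (m≤n+∣n-m∣ (rank u) (rank v)) (+-monoʳ-≤ (rank v) (near u∈L))

        slot-below-r : ∀ {u} → u ∈ L → slot u ∈ upTo r
        slot-below-r u∈L = ∈-upTo⁺ (slot-bound {rank v} {r * 2} (below u∈L) (four-lt-five 1≤r))

        slot-injective-on-L : ∀ {x y} → x ∈ L → y ∈ L → slot x ≡ slot y → x ≡ y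
        slot-injective-on-L x∈L y∈L same-slot = rank-injective _ _
          (slot-injective (above x∈L) (above y∈L)
            (five∣rank (proj₁ (inside x∈L))) (five∣rank (proj₁ (inside y∈L))) same-slot)

vertex-of-rank : ∀ {n} x → x < n * 2 → V n
vertex-of-rank {n} x x<2n = fromℕ< (m<n*o⇒m/o<n {x} {n} x<2n) , fromℕ< (m%n<n x 2)

rank-vertex-of-rank : ∀ {n} x (x<2n : x < n * 2) → rank (vertex-of-rank x x<2n) ≡ x
rank-vertex-of-rank {n} x x<2n = begin
  toℕ (fromℕ< (m<n*o⇒m/o<n {x} {n} x<2n)) * 2 + toℕ (fromℕ< (m%n<n x 2))
      ≡⟨ cong₂ (λ q ρ → q * 2 + ρ) (toℕ-fromℕ< (m<n*o⇒m/o<n {x} {n} x<2n)) (toℕ-fromℕ< (m%n<n x 2)) ⟩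
  x / 2 * 2 + x % 2   ≡⟨ +-comm (x / 2 * 2) (x % 2) ⟩
  x % 2 + x / 2 * 2   ≡⟨ m≡m%n+[m/n]*n x 2 ⟨
  x                   ∎
  where open ≡-Reasoning

below-ceil5 : ∀ {n t} → t < ceil5 (2 * n) → t * 5 < n * 2
below-ceil5 {n} {t} t<⌈2n/5⌉ = subst (t * 5 <_) (*-comm 2 n) (+-cancelˡ-≤ 4 (suc (t * 5)) (2 * n) (begin
  suc t * 5                    ≤⟨ *-monoˡ-≤ 5 t<⌈2n/5⌉ ⟩
  (2 * n + 4) / 5 * 5          ≤⟨ m/n*n≤m (2 * n + 4) 5 ⟩
  2 * n + 4                    ≡⟨ +-comm (2 * n) 4 ⟩
  4 + 2 * n                    ∎))
  where open ≤-Reasoning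

lattice-point : ∀ n → Fin (ceil5 (2 * n)) → V n
lattice-point n t = vertex-of-rank (toℕ t * 5) (below-ceil5 {n} (toℕ<n t))

rank-lattice-point : ∀ n t → rank (lattice-point n t) ≡ toℕ t * 5
rank-lattice-point n t = rank-vertex-of-rank {n} (toℕ t * 5) (below-ceil5 {n} (toℕ<n t))

lattice : (n : ℕ) → List (V n)
lattice n = tabulate (lattice-point n)

lattice-packing : ∀ n → IsMultipacking n (lattice n)
lattice-packing n = rank-multiple-of-5-packing (lattice n) (tabulate⁺ distinct) five∣rank
  where
    distinct : ∀ {s t} → lattice-point n s ≡ lattice-point n t → s ≡ t
    distinct {s} {t} e = toℕ-injective (*-cancelʳ-≡ (toℕ s) (toℕ t) 5
      (trans (sym (rank-lattice-point n s)) (trans (cong rank e) (rank-lattice-point n t))))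
    five∣rank : ∀ {u} → u ∈ lattice n → 5 ∣ rank u
    five∣rank u∈ with ∈-tabulate⁻ u∈
    ... | t , refl = divides (toℕ t) (rank-lattice-point n t)

proposition1 : (n : ℕ) → 1 ≤ n → MpEquals n (ceil5 (2 * n))
proposition1 n _ =
  (lattice n , lattice-packing n , length-tabulate _) ,
  λ M packing → Packing.size-bound packing
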